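{- Let $s\ge 2$ and let $G=K(n_1,\dots,n_s)$ be a complete $s$-partite graph with parts $V_1,\dots,V_s$, where $n_1\ge n_2\ge\cdots\ge n_s$, $3\le n_1\le 5$ and $n_2=1$. If $n_1\ge 4$, then there is an optimal $3$-relaxed coloring $f$ of $G$ with $|f(V_1)|=1$ (all vertices of $V_1$ get the same color). If $n_1=3$, then there is an optimal $3$-relaxed coloring of $G$ which assigns the same color to the three vertices of $V_1$ and the only vertex of $V_2$.
   Context: $K(n_1,\dots,n_s)$ denotes the complete $s$-partite graph whose parts $V_1,\dots,V_s$ have $n_1,\dots,n_s$ vertices. A $3$-relaxed $k$-coloring is a map $f:V\to\{1,\dots,k\}$ such that every vertex $u$ has at most $3$ neighbors $v$ with $f(v)=f(u)$; an optimal one uses $\chi_3(G)$ colors, the minimum possible $k$. -}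

module Defs where

open import Data.Nat using (ℕ; zero; suc; _≤_)
open import Data.Fin using (Fin; _≟_)
open import Data.List using (List; length; filter; concatMap; map; allFin)
open import Data.Product using (Σ; _,_; proj₁; _×_; ∃)
open import Relation.Nullary using (¬_; Dec; yes; no)
open import Relation.Nullary.Decidable using (_×-dec_; ¬?)
open import Relation.Binary.PropositionalEquality using (_≡_)

Vertex : (s : ℕ) → (Fin s → ℕ) → Set
Vertex s n = Σ (Fin s) (λ i → Fin (n i))

Adj : {s : ℕ} {n : Fin s → ℕ} → Vertex s n → Vertex s n → Set
Adj u v = ¬ (proj₁ u ≡ proj₁ v)

adj? : {s : ℕ} {n : Fin s → ℕ} (u v : Vertex s n) → Dec (Adj {s} {n} u v)
adj? u v = ¬? (proj₁ u ≟ proj₁ v)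

allVertices : (s : ℕ) (n : Fin s → ℕ) → List (Vertex s n)
allVertices s n = concatMap (λ i → map (i ,_) (allFin (n i))) (allFin s)

sameColourNbrs : {s : ℕ} {n : Fin s → ℕ} {k : ℕ} → (Vertex s n → Fin k) → Vertex s n → ℕ
sameColourNbrs {s} {n} f u =
  length (filter (λ v → adj? {s} {n} u v ×-dec (f v ≟ f u)) (allVertices s n))

Relaxed3 : {s : ℕ} {n : Fin s → ℕ} {k : ℕ} → (Vertex s n → Fin k) → Set
Relaxed3 {s} {n} f = ∀ u → sameColourNbrs {s} {n} f u ≤ 3

Optimal3 : {s : ℕ} {n : Fin s → ℕ} {k : ℕ} → (Vertex s n → Fin k) → Set
Optimal3 {s} {n} {k} f =
  Relaxed3 {s} {n} f × (∀ k' (g : Vertex s n → Fin k') → Relaxed3 {s} {n} g → k ≤ k')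

-- Put e = min(n₁, 4) and let m be the number of singleton parts.  Colour V₁
-- with 0 and the i-th singleton (counting from 0) with ⌊(e + i)/4⌋: the
-- singletons fall into consecutive blocks of four, the first one shortened
-- to 4 − e so that it shares colour 0 with V₁ (which then has e < 4 vertices
-- if that block is nonempty).  So a singleton has at most three neighbours
-- of its colour, a vertex of V₁ at most 4 − e ≤ 3, and ⌈(e + m)/4⌉ colours
-- are used.  Conversely, for any 3-relaxed colouring, a colour class among
-- e vertices of V₁ and all singletons has at most 4 members: either it lies
-- in V₁, or it contains a singleton u and otherwise only neighbours of u.
-- When n₁ = 3 the singleton V₂ lies in the first block, coloured like V₁.
module Submission where

open import Data.Bool using (true; false)
open import Data.Fin using (Fin; zero; suc; _≟_; toℕ; fromℕ<) renaming (_≤_ to _≤ᶠ_)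
open import Data.Fin.Properties using (any?; suc-injective; toℕ<n; toℕ-fromℕ<; fromℕ<-cong)
open import Data.List using (List; []; _∷_; [_]; _++_; length; filter; map; concat; tabulate; allFin; take)
open import Data.List.Properties
  using (length-++; length-map; length-tabulate; length-take; length-filter; map-tabulate;
         filter-++; filter-none; filter-≐; filter-accept; filter-reject)
open import Data.List.Membership.Propositional using (_∈_)
open import Data.List.Membership.Propositional.Properties using (∈-allFin)
open import Data.List.Relation.Unary.All using (All; universal)
open import Data.List.Relation.Unary.All.Properties using (¬Any⇒All¬)
open import Data.List.Relation.Unary.Any using (Any; here; there; satisfied)
open import Data.List.Relation.Unary.Any.Properties using (map⁻)
open import Data.List.Relation.Binary.Sublist.Heterogeneous.Properties using (length-mono-≤; ⊆-filter-Sublist)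
open import Data.List.Relation.Binary.Sublist.Propositional using (_⊆_; ⊆-refl; ⊆-trans; ⊆-reflexive)
open import Data.List.Relation.Binary.Sublist.Propositional.Properties using (++⁺; take-⊆)
open import Data.Nat using (ℕ; zero; suc; _+_; _*_; _∸_; _/_; _%_; _⊓_; _≤_; _<_; z≤n; s≤s; s≤s⁻¹) renaming (_≟_ to _≟ℕ_)
open import Data.Nat.DivMod using (m/n≡0⇒m<n; m/n*n≤m; m%n≡m∸m/n*n; m%n<n; m*n/n≡m; /-monoˡ-≤; m<n*o⇒m/o<n)
open import Data.Nat.Properties hiding (_≟_; suc-injective)
open import Algebra.Properties.CommutativeMonoid.Sum +-0-commutativeMonoid
  using (sum-syntax; sum-replicate-zero; sum-cong-≗; ∑-distrib-+)
open import Data.Product using (Σ; ∃; _×_; _,_; proj₁; proj₂)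
open import Data.Sum using (_⊎_; inj₁; inj₂)
open import Defs
open import Function using (_∘_; id)
open import Level using (Level)
open import Relation.Binary.Definitions using (DecidableEquality)
open import Relation.Binary.PropositionalEquality using (_≡_; refl; cong; cong₂; sym; trans; module ≡-Reasoning)
open import Relation.Nullary using (Dec; does; yes; no; ¬_; contradiction)
open import Relation.Nullary.Decidable using (_×-dec_; _⊎-dec_; ¬?)
open import Relation.Unary using (Pred; Decidable; ∁; _≐_)

private variable
  a p q r : Level
  A B : Set a

count : {P : Pred A p} → Decidable P → List A → ℕ
count P? xs = length (filter P? xs)

count-mono-⊆ : {P : Pred A p} {Q : Pred A q} (P? : Decidable P) (Q? : Decidable Q) →
  (∀ {x} → P x → Q x) → ∀ {xs ys} → xs ⊆ ys → count P? xs ≤ count Q? ys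
count-mono-⊆ P? Q? P⇒Q xs⊆ys = length-mono-≤ (⊆-filter-Sublist P? Q? (λ { refl → P⇒Q }) xs⊆ys)

count-≐ : {P : Pred A p} {Q : Pred A q} (P? : Decidable P) (Q? : Decidable Q) →
  P ≐ Q → ∀ xs → count P? xs ≡ count Q? xs
count-≐ P? Q? P≐Q xs = cong length (filter-≐ P? Q? P≐Q xs)

count-singleton : {P : Pred A p} {Q : Pred B q} (P? : Decidable P) (Q? : Decidable Q) {x : A} {y : B} →
  does (P? x) ≡ does (Q? y) → count P? [ x ] ≡ count Q? [ y ]
count-singleton P? Q? {x} {y} eq with does (P? x) | does (Q? y)
... | true  | true  = refl
... | false | false = refl
... | true  | false = contradiction eq λ ()
... | false | true  = contradiction eq λ ()

module _ {P : Pred A p} (P? : Decidable P) where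

  count-++ : ∀ xs ys → count P? (xs ++ ys) ≡ count P? xs + count P? ys
  count-++ xs ys = trans (cong length (filter-++ P? xs ys)) (length-++ (filter P? xs))

  count≤length : ∀ xs → count P? xs ≤ length xs
  count≤length = length-filter P?

  count-none : ∀ {xs} → All (∁ P) xs → count P? xs ≡ 0
  count-none ¬ps = cong length (filter-none P? ¬ps)

  count-map : (f : B → A) → ∀ xs → count P? (map f xs) ≡ count (P? ∘ f) xs
  count-map f [] = refl
  count-map f (x ∷ xs) with P? (f x)
  ... | yes _ = cong suc (count-map f xs)
  ... | no _  = count-map f xs

  count-⊎ : {Q : Pred A q} (Q? : Decidable Q) →
    ∀ xs → count (λ x → P? x ⊎-dec Q? x) xs ≤ count P? xs + count Q? xs
  count-⊎ Q? [] = z≤n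
  count-⊎ Q? (x ∷ xs) with does (P? x) | does (Q? x)
  ... | true  | true  = s≤s (≤-trans (count-⊎ Q? xs) (+-monoʳ-≤ _ (n≤1+n _)))
  ... | true  | false = s≤s (count-⊎ Q? xs)
  ... | false | true  = ≤-trans (s≤s (count-⊎ Q? xs)) (≤-reflexive (sym (+-suc _ _)))
  ... | false | false = count-⊎ Q? xs

  count-except : (_≟ₐ_ : DecidableEquality A) → ∀ {x xs} → P x → x ∈ xs →
    suc (count (λ y → P? y ×-dec ¬? (y ≟ₐ x)) xs) ≤ count P? xs
  count-except _≟ₐ_ {x} {_ ∷ xs} px (here refl) with P? x | x ≟ₐ x
  ... | yes _  | yes _  = s≤s (count-mono-⊆ (λ y → P? y ×-dec ¬? (y ≟ₐ x)) P? proj₁ (⊆-refl {x = xs}))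
  ... | yes _  | no x≢x = contradiction refl x≢x
  ... | no ¬px | _      = contradiction px ¬px
  count-except _≟ₐ_ {x} px (there {x = y} x∈xs) with does (P? y) | y ≟ₐ x
  ... | true  | yes _ = m≤n⇒m≤1+n (count-except _≟ₐ_ px x∈xs)
  ... | true  | no _  = s≤s (count-except _≟ₐ_ px x∈xs)
  ... | false | _     = count-except _≟ₐ_ px x∈xs

count-allFin-suc : ∀ {N} {P : Pred (Fin (suc N)) p} (P? : Decidable P) →
  count P? (allFin (suc N)) ≡ count P? [ zero ] + count (P? ∘ suc) (allFin N)
count-allFin-suc {N = N} P? = begin
  count P? ([ zero ] ++ tabulate suc)               ≡⟨ count-++ P? [ zero ] (tabulate suc) ⟩
  count P? [ zero ] + count P? (tabulate suc)       ≡⟨ cong (count P? [ zero ] +_) (cong (count P?) (map-tabulate id suc)) ⟨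
  count P? [ zero ] + count P? (map suc (allFin N)) ≡⟨ cong (count P? [ zero ] +_) (count-map P? suc (allFin N)) ⟩
  count P? [ zero ] + count (P? ∘ suc) (allFin N)   ∎
  where open ≡-Reasoning

count-allFin-≟ : ∀ {N} (y : Fin N) → count (y ≟_) (allFin N) ≡ 1
count-allFin-≟ {suc N} y = trans (count-allFin-suc (y ≟_)) (split y)
  where
  split : (y : Fin (suc N)) → count (y ≟_) [ zero ] + count (λ z → y ≟ suc z) (allFin N) ≡ 1
  split zero    = cong suc (count-none (λ z → zero ≟ suc z) (universal (λ _ ()) (allFin N)))
  split (suc y) = trans (count-≐ _ (y ≟_) (suc-injective , cong suc) (allFin N)) (count-allFin-≟ y)

count-concat-blocks : ∀ {N} {Q : Pred A q} {R : Pred (Fin N) r} (Q? : Decidable Q) (R? : Decidable R)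
  (h : Fin N → List A) → (∀ z → length (h z) ≤ 1) → (∀ z → Any Q (h z) → R z) →
  count Q? (concat (tabulate h)) ≤ count R? (allFin N)
count-concat-blocks {N = zero}  Q? R? h len≤1 Q⇒R = z≤n
count-concat-blocks {N = suc N} Q? R? h len≤1 Q⇒R = begin
  count Q? (h zero ++ concat (tabulate (h ∘ suc)))
    ≡⟨ count-++ Q? (h zero) _ ⟩
  count Q? (h zero) + count Q? (concat (tabulate (h ∘ suc)))
    ≤⟨ +-mono-≤ first (count-concat-blocks Q? (R? ∘ suc) (h ∘ suc) (len≤1 ∘ suc) (Q⇒R ∘ suc)) ⟩
  count R? [ zero ] + count (R? ∘ suc) (allFin N)
    ≡⟨ count-allFin-suc R? ⟨
  count R? (allFin (suc N)) ∎
  where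
  open ≤-Reasoning
  first : count Q? (h zero) ≤ count R? [ zero ]
  first with R? zero
  ... | yes _ = ≤-trans (count≤length Q? (h zero)) (len≤1 zero)
  ... | no ¬r = ≤-reflexive (count-none Q? (¬Any⇒All¬ (h zero) (¬r ∘ Q⇒R zero)))

suc-toℕ≤length-concat : ∀ {N} (h : Fin N → List A) (y : Fin N) →
  (∀ z → z ≤ᶠ y → 1 ≤ length (h z)) → suc (toℕ y) ≤ length (concat (tabulate h))
suc-toℕ≤length-concat h zero nonempty =
  ≤-trans (nonempty zero z≤n) (≤-trans (m≤m+n _ _) (≤-reflexive (sym (length-++ (h zero)))))
suc-toℕ≤length-concat h (suc y) nonempty = ≤-trans
  (+-mono-≤ (nonempty zero z≤n) (suc-toℕ≤length-concat (h ∘ suc) y (λ z z≤y → nonempty (suc z) (s≤s z≤y))))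
  (≤-reflexive (sym (length-++ (h zero))))

∑-count-singleton : ∀ {k} {R : Fin k → Pred A p} (R? : ∀ c → Decidable (R c)) x →
  ∑[ c < k ] count (R? c) [ x ] ≡ count (λ c → R? c x) (allFin k)
∑-count-singleton {k = zero}  R? x = refl
∑-count-singleton {k = suc k} R? x = begin
  count (R? zero) [ x ] + ∑[ c < k ] count (R? (suc c)) [ x ]
    ≡⟨ cong₂ _+_ (count-singleton (R? zero) (λ c → R? c x) refl) (∑-count-singleton (R? ∘ suc) x) ⟩
  count (λ c → R? c x) [ zero ] + count (λ c → R? (suc c) x) (allFin k)
    ≡⟨ count-allFin-suc (λ c → R? c x) ⟨
  count (λ c → R? c x) (allFin (suc k)) ∎
  where open ≡-Reasoning

∑-count-colour-classes : ∀ {k} (g : A → Fin k) xs → ∑[ c < k ] count (λ x → g x ≟ c) xs ≡ length xs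
∑-count-colour-classes {k = k} g [] = sum-replicate-zero k
∑-count-colour-classes {k = k} g (x ∷ xs) = begin
  ∑[ c < k ] count (class? c) (x ∷ xs)
    ≡⟨ sum-cong-≗ (λ c → count-++ (class? c) [ x ] xs) ⟩
  ∑[ c < k ] (count (class? c) [ x ] + count (class? c) xs)
    ≡⟨ ∑-distrib-+ (λ c → count (class? c) [ x ]) (λ c → count (class? c) xs) ⟩
  ∑[ c < k ] count (class? c) [ x ] + ∑[ c < k ] count (class? c) xs
    ≡⟨ cong₂ _+_ (trans (∑-count-singleton class? x) (count-allFin-≟ (g x))) (∑-count-colour-classes g xs) ⟩
  suc (length xs) ∎
  where
  open ≡-Reasoning
  class? : (c : Fin k) → Decidable (λ x → g x ≡ c)
  class? c x = g x ≟ c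

∑≤* : ∀ {k d} (w : Fin k → ℕ) → (∀ c → w c ≤ d) → ∑[ c < k ] w c ≤ k * d
∑≤* {k = zero}  w w≤d = z≤n
∑≤* {k = suc k} w w≤d = +-mono-≤ (w≤d zero) (∑≤* (w ∘ suc) (w≤d ∘ suc))

length≤colours*classSize : ∀ {k d} (g : A → Fin k) xs →
  (∀ c → count (λ x → g x ≟ c) xs ≤ d) → length xs ≤ k * d
length≤colours*classSize g xs class≤d =
  ≤-trans (≤-reflexive (sym (∑-count-colour-classes g xs))) (∑≤* _ class≤d)

-- Blocks of four consecutive numbers

count-/4≡-step : ∀ e c → count (λ x → x / 4 ≟ℕ c) [ e ] + (4 ∸ (suc e ∸ c * 4)) ≤ 4 ∸ (e ∸ c * 4)
count-/4≡-step e c with e / 4 ≟ℕ c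
... | yes refl = ≤-reflexive (begin
  count (λ x → x / 4 ≟ℕ e / 4) [ e ] + (4 ∸ (suc e ∸ e / 4 * 4))
    ≡⟨ cong₂ _+_ (cong length (filter-accept (λ x → x / 4 ≟ℕ e / 4) {x = e} {xs = []} refl))
                 (cong (4 ∸_) (trans (+-∸-assoc 1 (m/n*n≤m e 4)) (cong suc (sym (m%n≡m∸m/n*n e 4))))) ⟩
  1 + (4 ∸ suc (e % 4))
    ≡⟨ +-∸-assoc 1 (m%n<n e 4) ⟨
  4 ∸ e % 4
    ≡⟨ cong (4 ∸_) (m%n≡m∸m/n*n e 4) ⟩
  4 ∸ (e ∸ e / 4 * 4) ∎)
  where open ≡-Reasoning
... | no e/4≢c = begin
  count (λ x → x / 4 ≟ℕ c) [ e ] + (4 ∸ (suc e ∸ c * 4))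
    ≡⟨ cong (_+ (4 ∸ (suc e ∸ c * 4))) (cong length (filter-reject (λ x → x / 4 ≟ℕ c) {x = e} {xs = []} e/4≢c)) ⟩
  4 ∸ (suc e ∸ c * 4)
    ≤⟨ ∸-monoʳ-≤ 4 (∸-monoˡ-≤ (c * 4) (n≤1+n e)) ⟩
  4 ∸ (e ∸ c * 4) ∎
  where open ≤-Reasoning

count-/4≡ : ∀ N e c → count (λ (y : Fin N) → (e + toℕ y) / 4 ≟ℕ c) (allFin N) ≤ 4 ∸ (e ∸ c * 4)
count-/4≡ zero    e c = z≤n
count-/4≡ (suc N) e c = begin
  count P? (allFin (suc N))
    ≡⟨ count-allFin-suc P? ⟩
  count P? [ zero ] + count (P? ∘ suc) (allFin N)
    ≡⟨ cong₂ _+_ (count-singleton P? (λ x → x / 4 ≟ℕ c) {x = zero} {y = e} (cong (λ x → does (x / 4 ≟ℕ c)) (+-identityʳ e)))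
                 (count-≐ (P? ∘ suc) _ (shift , unshift) (allFin N)) ⟩
  count (λ x → x / 4 ≟ℕ c) [ e ] + count (λ y → (suc e + toℕ y) / 4 ≟ℕ c) (allFin N)
    ≤⟨ +-monoʳ-≤ _ (count-/4≡ N (suc e) c) ⟩
  count (λ x → x / 4 ≟ℕ c) [ e ] + (4 ∸ (suc e ∸ c * 4))
    ≤⟨ count-/4≡-step e c ⟩
  4 ∸ (e ∸ c * 4) ∎
  where
  open ≤-Reasoning
  P? : (y : Fin (suc N)) → Dec ((e + toℕ y) / 4 ≡ c)
  P? y = (e + toℕ y) / 4 ≟ℕ c
  shift : ∀ {y} → (e + suc (toℕ y)) / 4 ≡ c → (suc e + toℕ y) / 4 ≡ c
  shift {y} = trans (cong (_/ 4) (sym (+-suc e (toℕ y))))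
  unshift : ∀ {y} → (suc e + toℕ y) / 4 ≡ c → (e + suc (toℕ y)) / 4 ≡ c
  unshift {y} = trans (cong (_/ 4) (+-suc e (toℕ y)))

<⇒/4<⌈/4⌉ : ∀ {x z} → x < z → x / 4 < (3 + z) / 4
<⇒/4<⌈/4⌉ {x} {z} x<z = begin-strict
  x / 4                <⟨ n<1+n _ ⟩
  suc (x / 4)          ≡⟨ m*n/n≡m (suc (x / 4)) 4 ⟨
  suc (x / 4) * 4 / 4  ≤⟨ /-monoˡ-≤ 4 (+-monoʳ-≤ 4 (m/n*n≤m x 4)) ⟩
  (4 + x) / 4          ≤⟨ /-monoˡ-≤ 4 (+-monoʳ-≤ 3 x<z) ⟩
  (3 + z) / 4          ∎
  where open ≤-Reasoning

⌈/4⌉≤ : ∀ {m k} → m ≤ k * 4 → (3 + m) / 4 ≤ k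
⌈/4⌉≤ m≤k*4 = s≤s⁻¹ (m<n*o⇒m/o<n (s≤s (+-monoʳ-≤ 3 m≤k*4)))

-- Complete split graphs K(n₁, 1, …, 1, 0, …, 0)

module CompleteSplitGraph {s : ℕ} (n : Fin (suc s) → ℕ)
  (sorted : ∀ {y z} → z ≤ᶠ y → n (suc y) ≤ n (suc z))
  (thin : ∀ y → n (suc y) ≤ 1) where

  V : Set
  V = Vertex (suc s) n

  vertex : (i : Fin (suc s)) → Fin (n i) → V
  vertex i j = i , j

  part : Fin (suc s) → List V
  part i = map (vertex i) (allFin (n i))

  length-part : ∀ i → length (part i) ≡ n i
  length-part i = trans (length-map (vertex i) (allFin (n i))) (length-tabulate id)

  count-part-zero : {P : Pred V p} (P? : Decidable P) → (∀ {j} → ¬ P (zero , j)) → count P? (part zero) ≡ 0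
  count-part-zero P? ¬P =
    trans (count-map P? (vertex zero) (allFin _)) (count-none (P? ∘ vertex zero) (universal (λ _ → ¬P) (allFin _)))

  singletons : List V
  singletons = concat (tabulate (part ∘ suc))

  allVertices≡ : allVertices (suc s) n ≡ part zero ++ singletons
  allVertices≡ = cong (λ ps → part zero ++ concat ps) (map-tabulate suc part)

  count-singletons : {Q : Pred V q} {R : Pred (Fin s) r} (Q? : Decidable Q) (R? : Decidable R) →
    (∀ {y j} → Q (suc y , j) → R y) → count Q? singletons ≤ count R? (allFin s)
  count-singletons Q? R? Q⇒R = count-concat-blocks Q? R? (part ∘ suc)
    (λ y → ≤-trans (≤-reflexive (length-part (suc y))) (thin y))
    (λ y → Q⇒R ∘ proj₂ ∘ satisfied ∘ map⁻)

  count-same-part≤1 : ∀ y₀ → count (λ v → proj₁ v ≟ suc y₀) (allVertices (suc s) n) ≤ 1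
  count-same-part≤1 y₀ = begin
    count same-part? (allVertices (suc s) n)
      ≡⟨ cong (count same-part?) allVertices≡ ⟩
    count same-part? (part zero ++ singletons)
      ≡⟨ count-++ same-part? (part zero) singletons ⟩
    count same-part? (part zero) + count same-part? singletons
      ≡⟨ cong (_+ count same-part? singletons) (count-part-zero same-part? λ ()) ⟩
    count same-part? singletons
      ≤⟨ count-singletons same-part? (y₀ ≟_) (sym ∘ suc-injective) ⟩
    count (y₀ ≟_) (allFin s)
      ≡⟨ count-allFin-≟ y₀ ⟩
    1 ∎
    where
    open ≤-Reasoning
    same-part? : Decidable (λ v → proj₁ v ≡ suc y₀)
    same-part? v = proj₁ v ≟ suc y₀

  nbrs? : ∀ {m} (g : V → Fin m) (u : V) → Decidable (λ v → Adj {suc s} {n} u v × g v ≡ g u)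
  nbrs? g u v = adj? {suc s} {n} u v ×-dec (g v ≟ g u)

  sameColourNbrs-split : ∀ {m} (g : V → Fin m) u →
    sameColourNbrs {suc s} {n} g u ≡ count (nbrs? g u) (part zero) + count (nbrs? g u) singletons
  sameColourNbrs-split g u =
    trans (cong (count (nbrs? g u)) allVertices≡) (count-++ (nbrs? g u) (part zero) singletons)

  M : ℕ
  M = length singletons

  e : ℕ
  e = n zero ⊓ 4

  1≤e : Fin (n zero) → 1 ≤ e
  1≤e a = ⊓-glb (≤-<-trans z≤n (toℕ<n a)) (s≤s z≤n)

  colour : V → ℕ
  colour (zero , _)  = 0
  colour (suc y , _) = (e + toℕ y) / 4

  k : ℕ
  k = (3 + (e + M)) / 4

  -- Sortedness makes the nonempty singleton parts an initial segment, so index y is below M.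
  colour<k : ∀ v → colour v < k
  colour<k (zero , a)  = <⇒/4<⌈/4⌉ (≤-trans (1≤e a) (m≤m+n e M))
  colour<k (suc y , j) = <⇒/4<⌈/4⌉ (+-monoʳ-< e (suc-toℕ≤length-concat (part ∘ suc) y nonempty))
    where
    nonempty : ∀ z → z ≤ᶠ y → 1 ≤ length (part (suc z))
    nonempty z z≤y =
      ≤-trans (≤-trans (≤-<-trans z≤n (toℕ<n j)) (sorted z≤y)) (≤-reflexive (sym (length-part (suc z))))

  f : V → Fin k
  f v = fromℕ< (colour<k v)

  f≡⇒colour≡ : ∀ u v → f u ≡ f v → colour u ≡ colour v
  f≡⇒colour≡ u v fu≡fv =
    trans (sym (toℕ-fromℕ< (colour<k u))) (trans (cong toℕ fu≡fv) (toℕ-fromℕ< (colour<k v)))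

  colour≡⇒f≡ : ∀ u v → colour u ≡ colour v → f u ≡ f v
  colour≡⇒f≡ u v eq = fromℕ<-cong _ _ eq (colour<k u) (colour<k v)

  part-zero-budget : ∀ y₀ j₀ c → colour (suc y₀ , j₀) ≡ c →
    count (nbrs? f (suc y₀ , j₀)) (part zero) + (4 ∸ (e ∸ c * 4)) ≤ 4
  part-zero-budget y₀ j₀ zero colour≡0 = begin
    count (nbrs? f (suc y₀ , j₀)) (part zero) + (4 ∸ e)
      ≤⟨ +-monoˡ-≤ (4 ∸ e) (count≤length _ (part zero)) ⟩
    length (part zero) + (4 ∸ e)
      ≡⟨ cong (_+ (4 ∸ e)) (trans (length-part zero) n₀≡e) ⟩
    e + (4 ∸ e)
      ≡⟨ m+[n∸m]≡n (m⊓n≤n (n zero) 4) ⟩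
    4 ∎
    where
    open ≤-Reasoning
    e<4 : e < 4
    e<4 = ≤-<-trans (m≤m+n e (toℕ y₀)) (m/n≡0⇒m<n colour≡0)
    n₀≡e : n zero ≡ e
    n₀≡e with ⊓-sel (n zero) 4
    ... | inj₁ e≡n₀ = sym e≡n₀
    ... | inj₂ e≡4  = contradiction e≡4 (<⇒≢ e<4)
  part-zero-budget y₀ j₀ (suc c) colour≡1+c = begin
    count (nbrs? f (suc y₀ , j₀)) (part zero) + (4 ∸ (e ∸ suc c * 4))
      ≡⟨ cong (_+ (4 ∸ (e ∸ suc c * 4))) (count-part-zero (nbrs? f (suc y₀ , j₀)) (λ {j} → other-colour {j})) ⟩
    4 ∸ (e ∸ suc c * 4)
      ≤⟨ m∸n≤m 4 (e ∸ suc c * 4) ⟩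
    4 ∎
    where
    open ≤-Reasoning
    other-colour : ∀ {j} → ¬ (Adj {suc s} {n} (suc y₀ , j₀) (zero , j) × f (zero , j) ≡ f (suc y₀ , j₀))
    other-colour {j} (_ , same) = 0≢1+n (trans (f≡⇒colour≡ (zero , j) (suc y₀ , j₀) same) colour≡1+c)

  relaxed : Relaxed3 {suc s} {n} f
  relaxed u@(zero , a) = begin
    sameColourNbrs {suc s} {n} f u
      ≡⟨ sameColourNbrs-split f u ⟩
    count (nbrs? f u) (part zero) + count (nbrs? f u) singletons
      ≡⟨ cong (_+ count (nbrs? f u) singletons) (count-part-zero (nbrs? f u) (λ (nonadj , _) → nonadj refl)) ⟩
    count (nbrs? f u) singletons
      ≤⟨ count-singletons (nbrs? f u) (λ y → (e + toℕ y) / 4 ≟ℕ 0) (λ {y} {j} (_ , same) → f≡⇒colour≡ (suc y , j) u same) ⟩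
    count (λ y → (e + toℕ y) / 4 ≟ℕ 0) (allFin s)
      ≤⟨ count-/4≡ s e 0 ⟩
    4 ∸ e
      ≤⟨ ∸-monoʳ-≤ 4 (1≤e a) ⟩
    3 ∎
    where open ≤-Reasoning
  relaxed u@(suc y₀ , j₀) = ≤-trans (≤-reflexive (sameColourNbrs-split f u)) (s≤s⁻¹ (begin
    suc (count (nbrs? f u) (part zero) + count (nbrs? f u) singletons)
      ≡⟨ +-suc _ _ ⟨
    count (nbrs? f u) (part zero) + suc (count (nbrs? f u) singletons)
      ≤⟨ +-monoʳ-≤ _ (<-≤-trans (s≤s others) (count-except same-block? _≟_ refl (∈-allFin y₀))) ⟩
    count (nbrs? f u) (part zero) + count same-block? (allFin s)
      ≤⟨ +-monoʳ-≤ _ (count-/4≡ s e (colour u)) ⟩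
    count (nbrs? f u) (part zero) + (4 ∸ (e ∸ colour u * 4))
      ≤⟨ part-zero-budget y₀ j₀ (colour u) refl ⟩
    4 ∎))
    where
    open ≤-Reasoning
    same-block? : Decidable (λ y → (e + toℕ y) / 4 ≡ colour u)
    same-block? y = (e + toℕ y) / 4 ≟ℕ colour u
    others : count (nbrs? f u) singletons ≤ count (λ y → same-block? y ×-dec ¬? (y ≟ y₀)) (allFin s)
    others = count-singletons _ _ λ {y} {j} (nonadj , same) →
      f≡⇒colour≡ (suc y , j) u same , λ { refl → nonadj refl }

  module LowerBound {m} (g : V → Fin m) (g-relaxed : Relaxed3 {suc s} {n} g) where

    witnesses : List V
    witnesses = take e (part zero) ++ singletons

    witnesses⊆allVertices : witnesses ⊆ allVertices (suc s) n
    witnesses⊆allVertices = ⊆-trans (++⁺ (take-⊆ e (part zero)) ⊆-refl) (⊆-reflexive (sym allVertices≡))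

    length-witnesses : length witnesses ≡ e + M
    length-witnesses = begin
      length witnesses                 ≡⟨ length-++ (take e (part zero)) ⟩
      length (take e (part zero)) + M  ≡⟨ cong (_+ M) (length-take e (part zero)) ⟩
      e ⊓ length (part zero) + M       ≡⟨ cong (λ l → e ⊓ l + M) (length-part zero) ⟩
      e ⊓ n zero + M                   ≡⟨ cong (_+ M) (m≤n⇒m⊓n≡m (m⊓n≤m (n zero) 4)) ⟩
      e + M                            ∎
      where open ≡-Reasoning

    class? : (c : Fin m) → Decidable (λ v → g v ≡ c)
    class? c v = g v ≟ c

    class≤4-without-singleton : ∀ c → ¬ (∃ λ y → ∃ λ j → g (suc y , j) ≡ c) → count (class? c) witnesses ≤ 4
    class≤4-without-singleton c none = begin
      count (class? c) witnesses
        ≡⟨ count-++ (class? c) (take e (part zero)) singletons ⟩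
      count (class? c) (take e (part zero)) + count (class? c) singletons
        ≤⟨ +-mono-≤ (count≤length (class? c) (take e (part zero))) (count-singletons (class? c) has-colour? (_ ,_)) ⟩
      length (take e (part zero)) + count has-colour? (allFin s)
        ≡⟨ cong₂ _+_ (length-take e (part zero)) (count-none has-colour? (universal (λ y → none ∘ (y ,_)) (allFin s))) ⟩
      e ⊓ length (part zero) + 0
        ≤⟨ +-monoˡ-≤ 0 (≤-trans (m⊓n≤m e _) (m⊓n≤n (n zero) 4)) ⟩
      4 ∎
      where
      open ≤-Reasoning
      has-colour? : Decidable (λ y → ∃ λ j → g (suc y , j) ≡ c)
      has-colour? y = any? (λ j → g (suc y , j) ≟ c)

    class≤4-with-singleton : ∀ c y₀ j₀ → g (suc y₀ , j₀) ≡ c → count (class? c) witnesses ≤ 4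
    class≤4-with-singleton c y₀ j₀ gu≡c = begin
      count (class? c) witnesses
        ≤⟨ count-mono-⊆ (class? c) nbr-or-same-part? nbr-or-same-part witnesses⊆allVertices ⟩
      count nbr-or-same-part? (allVertices (suc s) n)
        ≤⟨ count-⊎ (nbrs? g u) same-part? (allVertices (suc s) n) ⟩
      sameColourNbrs {suc s} {n} g u + count same-part? (allVertices (suc s) n)
        ≤⟨ +-mono-≤ (g-relaxed u) (count-same-part≤1 y₀) ⟩
      3 + 1 ∎
      where
      open ≤-Reasoning
      u = suc y₀ , j₀
      same-part? : Decidable (λ v → proj₁ v ≡ suc y₀)
      same-part? v = proj₁ v ≟ suc y₀
      nbr-or-same-part? : Decidable (λ v → (Adj {suc s} {n} u v × g v ≡ g u) ⊎ proj₁ v ≡ suc y₀)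
      nbr-or-same-part? v = nbrs? g u v ⊎-dec same-part? v
      nbr-or-same-part : ∀ {v} → g v ≡ c → (Adj {suc s} {n} u v × g v ≡ g u) ⊎ proj₁ v ≡ suc y₀
      nbr-or-same-part {v} gv≡c with same-part? v
      ... | yes same = inj₂ same
      ... | no other = inj₁ (other ∘ sym , trans gv≡c (sym gu≡c))

    class≤4 : ∀ c → count (class? c) witnesses ≤ 4
    class≤4 c with any? (λ y → any? (λ j → g (suc y , j) ≟ c))
    ... | no none              = class≤4-without-singleton c none
    ... | yes (y₀ , j₀ , gu≡c) = class≤4-with-singleton c y₀ j₀ gu≡c

    k≤m : k ≤ m
    k≤m = ⌈/4⌉≤ (≤-trans (≤-reflexive (sym length-witnesses)) (length≤colours*classSize g witnesses class≤4))

  optimal : Optimal3 {suc s} {n} f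
  optimal = relaxed , λ m g g-relaxed → LowerBound.k≤m g g-relaxed

  f-part-zero : ∀ a b → f (zero , a) ≡ f (zero , b)
  f-part-zero a b = colour≡⇒f≡ (zero , a) (zero , b) refl

  f-part-zero≡f-suc : ∀ {y} a b → (e + toℕ y) / 4 ≡ 0 → f (zero , a) ≡ f (suc y , b)
  f-part-zero≡f-suc {y} a b first-block = colour≡⇒f≡ (zero , a) (suc y , b) (sym first-block)

lemma5p5 : (t : ℕ) (n : Fin (suc (suc t)) → ℕ) →
    (∀ i j → i ≤ᶠ j → n j ≤ n i) →
    3 ≤ n Fin.zero → n Fin.zero ≤ 5 → n (Fin.suc Fin.zero) ≡ 1 →
    (4 ≤ n Fin.zero →
      Σ ℕ λ k → Σ (Vertex (suc (suc t)) n → Fin k) λ f →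
        Optimal3 {suc (suc t)} {n} f ×
        (∀ a b → f (Fin.zero , a) ≡ f (Fin.zero , b)))
    ×
    (n Fin.zero ≡ 3 →
      Σ ℕ λ k → Σ (Vertex (suc (suc t)) n → Fin k) λ f →
        Optimal3 {suc (suc t)} {n} f ×
        (∀ a b → f (Fin.zero , a) ≡ f (Fin.zero , b)) ×
        (∀ a b → f (Fin.zero , a) ≡ f (Fin.suc Fin.zero , b)))
lemma5p5 t n sorted _ _ n₂≡1 =
  (λ _ → G.k , G.f , G.optimal , G.f-part-zero) ,
  (λ n₁≡3 → G.k , G.f , G.optimal , G.f-part-zero ,
    λ a b → G.f-part-zero≡f-suc a b (cong (λ n₁ → (n₁ ⊓ 4 + 0) / 4) n₁≡3))
  where
  module G = CompleteSplitGraph n (λ z≤y → sorted _ _ (s≤s z≤y))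
    (λ y → ≤-trans (sorted (suc zero) (suc y) (s≤s z≤n)) (≤-reflexive n₂≡1))
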